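{- Let $A$ be an open parity game and $i$ an entrance. Then: (1) $i$ is winning iff $\mathrm{PF}(A,i)=\{\{\top\}\}$; (2) $i$ is losing iff $\mathrm{PF}(A,i)=\{\{\bot\}\}$; (3) $i$ is pending iff for every $T\in\mathrm{PF}(A,i)$ we have $\top,\bot\notin T$, and for all $(o_1,m_1),(o_2,m_2)\in T$, $o_1=o_2$ implies $m_1=m_2$.
   Context: Fix priorities $\mathbb{P}=\{0,1,\dots,M\}$ with $M\ge 2$ even. A parity game is $G=(V,V_\exists,V_\forall,E,\Omega)$ with $V$ nonempty finite, $(V_\exists,V_\forall)$ a partition, $E\subseteq V\times V$ with every node having a successor, $\Omega\colon E\to\mathbb{P}$. A play is an infinite path along edges; it satisfies parity if the largest priority occurring infinitely often is even. Strategies of $\exists$ (resp. $\forall$) map finite paths ending in $V_\exists$ (resp. $V_\forall$) to a successor of the last node; $\mathrm{play}(\sigma_\exists,\sigma_\forall,v)$ is the induced play from $v$. An open parity game (oPG) $A$ is a parity game with pairwise disjoint, totally ordered sets $I_r,I_l,O_r,O_l\subseteq V_\exists$; entrances $I=I_r\cup I_l$, exits $O=O_r\cup O_l$; every exit $o$ is a sink with only edge $(o,o)$ and $\Omega(o,o)=0$. Domain $D(A)=\{\bot,\top\}\cup(O\times\mathbb{P})$. Denotation of a play $p=(v_j)$: $\top$ if no exit is visited and parity holds; $(o,m)$ if exit $o$ is visited, $j$ the first index with $v_j=o$, $m=\max\{\Omega(v_k,v_{k+1}):1\le k\le j-1\}$; $\bot$ if no exit is visited and parity fails. Denotation of entrance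 $i$: $[\![i]\!]=\{\{[\![\mathrm{play}(\sigma_\exists,\sigma_\forall,i)]\!]:\sigma_\forall\text{ a }\forall\text{ -strategy}\}:\sigma_\exists\text{ an }\exists\text{ -strategy}\}$. The entrance $i$ is winning if $\{\top\}\in[\![i]\!]$, losing if $\bot\in T$ for every $T\in[\![i]\!]$, and pending otherwise. Sub-priority order $\preceq_{\mathbb P}$: $M-1\prec M-3\prec\cdots\prec1\prec0\prec2\prec\cdots\prec M$. Domain order: $d_1\preceq_D d_2$ iff $d_1=\bot$, or $d_2=\top$, or $d_1=(o,m_1),d_2=(o,m_2)$ with $m_1\preceq_{\mathbb P}m_2$. $\min T$ = $\preceq_D$-minimal elements. Upper preorder: $T_1\preceq_U T_2$ iff every $d_2\in T_2$ has some $d_1\in T_1$ with $d_1\preceq_D d_2$; $\max S$ = $\preceq_U$-maximal elements. Pareto front: $\mathrm{PF}(A,i)=\max\{\min\{[\![\mathrm{play}(\sigma_\exists,\sigma_\forall,i)]\!]:\sigma_\forall\}:\sigma_\exists\}$ over arbitrary strategies. -}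

module Defs where

open import Level using (0ℓ)
open import Data.Nat using (ℕ; zero; suc; _≤_; _<_; _⊔_)
open import Data.Nat.Divisibility using (_∣_)
open import Data.Fin using (Fin; toℕ)
open import Data.Bool using (Bool; true; false)
open import Data.List using (List; []; _∷_)
open import Data.List.Membership.Propositional using (_∈_)
open import Data.List.Relation.Unary.Unique.Propositional using (Unique)
open import Data.Product using (Σ; ∃; _×_; _,_; proj₁; proj₂)
open import Data.Sum using (_⊎_)
open import Data.Empty using (⊥)
open import Relation.Nullary using (¬_)
open import Relation.Binary.PropositionalEquality using (_≡_; _≢_)
open import Function.Bundles using (_⇔_)

-- Priorities {0,…,M} are Fin (suc M); nodes are Fin (suc n) (so V is
-- nonempty and finite).

Prio : ℕ → Set
Prio M = Fin (suc M)

Node : ℕ → Set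
Node n = Fin (suc n)

EvenN : ℕ → Set
EvenN m = 2 ∣ m

OddN : ℕ → Set
OddN m = ¬ (2 ∣ m)

Disjoint : {X : Set} → List X → List X → Set
Disjoint xs ys = ∀ v → v ∈ xs → v ∈ ys → ⊥

-- Open parity games.  isE v ≡ true means v ∈ V∃ (otherwise v ∈ V∀).
-- edge u v ≡ true means (u,v) ∈ E; Ω u v is the priority of the edge
-- (u,v) (its value on non-edges is irrelevant).  The totally ordered
-- sets I_r, I_l, O_r, O_l are duplicate-free lists (list order = the
-- total order).

record OPG (M n : ℕ) : Set where
  field
    isE   : Node n → Bool
    edge  : Node n → Node n → Bool
    Ω     : Node n → Node n → Prio M
    total : ∀ v → Σ (Node n) λ w → edge v w ≡ true
    Ir Il Or Ol : List (Node n)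
    uIr : Unique Ir
    uIl : Unique Il
    uOr : Unique Or
    uOl : Unique Ol
    d-IrIl : Disjoint Ir Il
    d-IrOr : Disjoint Ir Or
    d-IrOl : Disjoint Ir Ol
    d-IlOr : Disjoint Il Or
    d-IlOl : Disjoint Il Ol
    d-OrOl : Disjoint Or Ol
    Ir⊆∃ : ∀ v → v ∈ Ir → isE v ≡ true
    Il⊆∃ : ∀ v → v ∈ Il → isE v ≡ true
    Or⊆∃ : ∀ v → v ∈ Or → isE v ≡ true
    Ol⊆∃ : ∀ v → v ∈ Ol → isE v ≡ true
    exit-loop : ∀ o → (o ∈ Or ⊎ o ∈ Ol) → edge o o ≡ true
    exit-sink : ∀ o → (o ∈ Or ⊎ o ∈ Ol) → ∀ w → edge o w ≡ true → w ≡ o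
    exit-Ω    : ∀ o → (o ∈ Or ⊎ o ∈ Ol) → Ω o o ≡ Fin.zero

-- The domain.  ex o m stands for (o,m); only exits o ever occur in
-- denotations.

data Dom (n M : ℕ) : Set where
  bot : Dom n M
  top : Dom n M
  ex  : Node n → Prio M → Dom n M

-- Sub-priority order  M-1 ≺ M-3 ≺ … ≺ 1 ≺ 0 ≺ 2 ≺ … ≺ M
_⪯P_ : {M : ℕ} → Prio M → Prio M → Set
a ⪯P b = (OddN (toℕ a) × EvenN (toℕ b))
       ⊎ (OddN (toℕ a) × OddN (toℕ b) × toℕ b ≤ toℕ a)
       ⊎ (EvenN (toℕ a) × EvenN (toℕ b) × toℕ a ≤ toℕ b)

_⪯D_ : {n M : ℕ} → Dom n M → Dom n M → Set
_⪯D_ {n} {M} d₁ d₂ =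
  (d₁ ≡ bot) ⊎ (d₂ ≡ top)
  ⊎ (Σ (Node n) λ o → Σ (Prio M) λ m₁ → Σ (Prio M) λ m₂ →
       d₁ ≡ ex o m₁ × d₂ ≡ ex o m₂ × m₁ ⪯P m₂)

DSet : ℕ → ℕ → Set₁
DSet n M = Dom n M → Set

minD : {n M : ℕ} → DSet n M → DSet n M
minD T d = T d × (∀ d' → T d' → d' ⪯D d → d' ≡ d)

_⪯U_ : {n M : ℕ} → DSet n M → DSet n M → Set
_⪯U_ {n} {M} T₁ T₂ = ∀ (d₂ : Dom n M) → T₂ d₂ → Σ (Dom n M) λ d₁ → T₁ d₁ × d₁ ⪯D d₂

_≐_ : {n M : ℕ} → DSet n M → DSet n M → Set
T₁ ≐ T₂ = ∀ d → (T₁ d → T₂ d) × (T₂ d → T₁ d)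

maxU : {n M : ℕ} → (DSet n M → Set) → (DSet n M → Set₁)
maxU S T = S T × (∀ T' → S T' → T ⪯U T' → T' ⪯U T)

singleton : {n M : ℕ} → Dom n M → DSet n M
singleton d d' = d' ≡ d

module Sem {M n : ℕ} (A : OPG M n) where
  open OPG A

  V : Set
  V = Node n

  IsExit : V → Set
  IsExit o = o ∈ Or ⊎ o ∈ Ol

  IsEntrance : V → Set
  IsEntrance i = i ∈ Ir ⊎ i ∈ Il

  data Path : V → Set where
    start : (v : V) → Path v
    step  : ∀ {u} → Path u → (w : V) → edge u w ≡ true → Path w

  Strat∃ : Set
  Strat∃ = ∀ {v} → Path v → isE v ≡ true → Σ V λ w → edge v w ≡ true

  Strat∀ : Set
  Strat∀ = ∀ {v} → Path v → isE v ≡ false → Σ V λ w → edge v w ≡ true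

  private
    move : Strat∃ → Strat∀ → ∀ {v} → Path v → (b : Bool) → isE v ≡ b →
           Σ V λ w → edge v w ≡ true
    move σ τ h true  e = σ h e
    move σ τ h false e = τ h e

    prefix : Strat∃ → Strat∀ → V → ℕ → Σ V Path
    prefix σ τ v zero = v , start v
    prefix σ τ v (suc k) with prefix σ τ v k
    ... | u , h with move σ τ h (isE u) Relation.Binary.PropositionalEquality.refl
    ... | w , e = w , step h w e

  Play : Set
  Play = ℕ → V

  -- play(σ∃, σ∀, v), indexed from 0 (p 0 = v)
  play : Strat∃ → Strat∀ → V → Play
  play σ τ v k = proj₁ (prefix σ τ v k)

  prio : Play → ℕ → ℕ
  prio p k = toℕ (Ω (p k) (p (suc k)))

  InfOften : Play → ℕ → Set
  InfOften p m = ∀ N → Σ ℕ λ k → N ≤ k × prio p k ≡ m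

  Parity : Play → Set
  Parity p = Σ ℕ λ m → InfOften p m × (∀ m' → InfOften p m' → m' ≤ m) × EvenN m

  -- maximum of the priorities of the first j edges (p 0,p 1),…,(p (j-1),p j)
  maxUpTo : Play → ℕ → ℕ
  maxUpTo p zero    = 0
  maxUpTo p (suc j) = maxUpTo p j ⊔ prio p j

  NoExit : Play → Set
  NoExit p = ∀ k → ¬ IsExit (p k)

  -- Denotation of a play, as a (functional) relation
  Den : Play → Dom n M → Set
  Den p bot      = NoExit p × ¬ Parity p
  Den p top      = NoExit p × Parity p
  Den p (ex o m) = IsExit o × Σ ℕ λ j → p j ≡ o × (∀ k → k < j → p k ≢ o)
                   × toℕ m ≡ maxUpTo p j

  Outcomes : Strat∃ → V → DSet n M
  Outcomes σ i d = Σ Strat∀ λ τ → Den (play σ τ i) d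

  -- ⟦i⟧ as a set of sets (membership up to extensional equality)
  Denot : V → DSet n M → Set
  Denot i T = Σ Strat∃ λ σ → T ≐ Outcomes σ i

  Winning : V → Set
  Winning i = Denot i (singleton top)

  Losing : V → Set₁
  Losing i = ∀ T → Denot i T → T bot

  Pending : V → Set₁
  Pending i = ¬ Winning i × ¬ Losing i

  MinSets : V → DSet n M → Set
  MinSets i T = Σ Strat∃ λ σ → T ≐ minD (Outcomes σ i)

  PF : V → DSet n M → Set₁
  PF i = maxU (MinSets i)

  -- PF(A,i) = {T₀}  (as a set of sets, up to extensional equality)
  PFIs : V → DSet n M → Set₁
  PFIs i T₀ = ∀ T → (PF i T → T ≐ T₀) × (T ≐ T₀ → PF i T)

  PendingShape : V → Set₁
  PendingShape i = ∀ T → PF i T →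
      ¬ T top × ¬ T bot
    × (∀ o₁ m₁ o₂ m₂ → T (ex o₁ m₁) → T (ex o₂ m₂) → o₁ ≡ o₂ → m₁ ≡ m₂)

-- Winning means some ∃-strategy forces ⊤, so {⊤} is a min-set; every min-set is
-- nonempty and ⊤ is the top of ⪯D, hence {⊤} lies ⪯U-above every min-set and is the
-- unique Pareto-optimal one.  Losing means ⊥ is an outcome of every ∃-strategy, so
-- every min-set is {⊥}.  For a Pareto-optimal min-set T: ⊤ ∈ T makes ⊤ a minimal
-- outcome, i.e. a win; ⊥ ∈ T puts T ⪯U-below every min-set, so by maximality ⊥ lies
-- in every min-set, i.e. a loss; and two minimal outcomes at the same exit carry the
-- same priority because ⪯P is total.  Excluded middle is used to give every play a
-- denotation and to find minimal outcomes, ⪯D being well founded via a rank into ℕ.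
module Submission where

open import Defs
open import Axiom.ExcludedMiddle using (ExcludedMiddle)
open import Axiom.DoubleNegationElimination using (em⇒dne)
open import Level using (0ℓ; lift; lower)
open import Data.Nat using (ℕ; zero; suc; _+_; _∸_; _≤_; _<_; z≤n; s≤s)
open import Data.Nat.Properties
open import Data.Nat.Induction using (<-wellFounded)
open import Data.Nat.Divisibility using (_∣?_)
open import Data.Fin using (toℕ; fromℕ<)
open import Data.Fin.Properties using (toℕ<n; toℕ-injective; toℕ-fromℕ<)
open import Data.Product using (∃; _×_; _,_; proj₁; proj₂)
open import Data.Sum using (_⊎_; inj₁; inj₂)
open import Data.Empty using (⊥-elim)
open import Function.Bundles using (_⇔_; mk⇔)
open import Induction.WellFounded using (WellFounded; Acc; acc; module Subrelation)
import Relation.Binary.Construct.On as On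
open import Relation.Binary.Core using (Rel)
open import Relation.Nullary using (¬_; yes; no)
open import Relation.Nullary.Decidable using (map′)
open import Relation.Binary.PropositionalEquality using (_≡_; _≢_; refl; sym; trans; cong; subst)

lowerEM : ∀ {ℓ} → ExcludedMiddle (Level.suc ℓ) → ExcludedMiddle ℓ
lowerEM em = map′ lower lift em

wellFounded⇒minimal : ∀ {A : Set} {_<_ : Rel A 0ℓ} → ExcludedMiddle 0ℓ → WellFounded _<_ →
                      (P : A → Set) → ∀ {x} → P x → ∃ λ y → P y × (∀ {z} → z < y → ¬ P z)
wellFounded⇒minimal {_<_ = _<_} em wf P {x} px = go (wf x) px
  where
  go : ∀ {x} → Acc _<_ x → P x → ∃ λ y → P y × (∀ {z} → z < y → ¬ P z)
  go {x} (acc rs) px with em {∃ λ z → z < x × P z}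
  ... | yes (z , z<x , pz) = go (rs z<x) pz
  ... | no nothing-below = x , px , λ z<x pz → nothing-below (_ , z<x , pz)

module _ {M : ℕ} where

  ⪯P-total : (a b : Prio M) → a ⪯P b ⊎ b ⪯P a
  ⪯P-total a b with 2 ∣? toℕ a | 2 ∣? toℕ b
  ... | yes a-even | yes b-even with ≤-total (toℕ a) (toℕ b)
  ...   | inj₁ a≤b = inj₁ (inj₂ (inj₂ (a-even , b-even , a≤b)))
  ...   | inj₂ b≤a = inj₂ (inj₂ (inj₂ (b-even , a-even , b≤a)))
  ⪯P-total a b | yes a-even | no b-odd = inj₂ (inj₁ (b-odd , a-even))
  ⪯P-total a b | no a-odd | yes b-even = inj₁ (inj₁ (a-odd , b-even))
  ⪯P-total a b | no a-odd | no b-odd with ≤-total (toℕ b) (toℕ a)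
  ...   | inj₁ b≤a = inj₁ (inj₂ (inj₁ (a-odd , b-odd , b≤a)))
  ...   | inj₂ a≤b = inj₂ (inj₂ (inj₁ (b-odd , a-odd , a≤b)))

  -- Odd priorities are ranked M ∸ a ≤ M and even ones M + 1 + a, turning ⪯P into ≤.
  subRank : Prio M → ℕ
  subRank a with 2 ∣? toℕ a
  ... | yes _ = suc (M + toℕ a)
  ... | no _  = M ∸ toℕ a

  subRank-even : ∀ a → EvenN (toℕ a) → subRank a ≡ suc (M + toℕ a)
  subRank-even a a-even with 2 ∣? toℕ a
  ... | yes _ = refl
  ... | no a-odd = ⊥-elim (a-odd a-even)

  subRank-odd : ∀ a → OddN (toℕ a) → subRank a ≡ M ∸ toℕ a
  subRank-odd a a-odd with 2 ∣? toℕ a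
  ... | yes a-even = ⊥-elim (a-odd a-even)
  ... | no _ = refl

  toℕ≤M : (a : Prio M) → toℕ a ≤ M
  toℕ≤M a = ≤-pred (toℕ<n a)

  subRank≤ : ∀ a → subRank a ≤ suc (M + M)
  subRank≤ a with 2 ∣? toℕ a
  ... | yes _ = s≤s (+-monoʳ-≤ M (toℕ≤M a))
  ... | no _  = ≤-trans (m∸n≤m M (toℕ a)) (≤-trans (m≤m+n M M) (n≤1+n _))

  subRank-strictMono : ∀ {a b} → a ⪯P b → a ≢ b → subRank a < subRank b
  subRank-strictMono {a} {b} (inj₁ (a-odd , b-even)) _
    rewrite subRank-odd a a-odd | subRank-even b b-even =
    s≤s (≤-trans (m∸n≤m M (toℕ a)) (m≤m+n M (toℕ b)))
  subRank-strictMono {a} {b} (inj₂ (inj₁ (a-odd , b-odd , b≤a))) a≢b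
    rewrite subRank-odd a a-odd | subRank-odd b b-odd =
    ∸-monoʳ-< (≤∧≢⇒< b≤a (λ eq → a≢b (toℕ-injective (sym eq)))) (toℕ≤M a)
  subRank-strictMono {a} {b} (inj₂ (inj₂ (a-even , b-even , a≤b))) a≢b
    rewrite subRank-even a a-even | subRank-even b b-even =
    s≤s (+-monoʳ-< M (≤∧≢⇒< a≤b (λ eq → a≢b (toℕ-injective eq))))

module _ {n M : ℕ} where

  _≺D_ : Dom n M → Dom n M → Set
  d ≺D d′ = d ⪯D d′ × d ≢ d′

  rank : Dom n M → ℕ
  rank bot      = 0
  rank (ex _ m) = suc (subRank m)
  rank top      = suc (suc (suc (M + M)))

  ≺D⇒rank< : ∀ {d d′} → d ≺D d′ → rank d < rank d′
  ≺D⇒rank< {bot} {bot} (_ , d≢d′) = ⊥-elim (d≢d′ refl)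
  ≺D⇒rank< {bot} {top} _ = s≤s z≤n
  ≺D⇒rank< {bot} {ex _ _} _ = s≤s z≤n
  ≺D⇒rank< {top} (inj₁ () , _)
  ≺D⇒rank< {top} (inj₂ (inj₁ refl) , d≢d′) = ⊥-elim (d≢d′ refl)
  ≺D⇒rank< {top} (inj₂ (inj₂ (_ , _ , _ , () , _)) , _)
  ≺D⇒rank< {ex _ m} {top} _ = s≤s (s≤s (subRank≤ m))
  ≺D⇒rank< {ex _ _} {bot} (inj₁ () , _)
  ≺D⇒rank< {ex _ _} {bot} (inj₂ (inj₁ ()) , _)
  ≺D⇒rank< {ex _ _} {bot} (inj₂ (inj₂ (_ , _ , _ , _ , () , _)) , _)
  ≺D⇒rank< {ex _ _} {ex _ _} (inj₁ () , _)
  ≺D⇒rank< {ex _ _} {ex _ _} (inj₂ (inj₁ ()) , _)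
  ≺D⇒rank< {ex o _} {ex _ _} (inj₂ (inj₂ (_ , _ , _ , refl , refl , m⪯m′)) , d≢d′) =
    s≤s (subRank-strictMono m⪯m′ (λ m≡m′ → d≢d′ (cong (ex o) m≡m′)))

  ≺D-wellFounded : WellFounded _≺D_
  ≺D-wellFounded = Subrelation.wellFounded ≺D⇒rank< (On.wellFounded rank <-wellFounded)

  top⪯⇒≡top : ∀ {d : Dom n M} → top ⪯D d → d ≡ top
  top⪯⇒≡top (inj₁ ())
  top⪯⇒≡top (inj₂ (inj₁ d≡top)) = d≡top
  top⪯⇒≡top (inj₂ (inj₂ (_ , _ , _ , () , _)))

  ⪯bot⇒≡bot : ∀ {d : Dom n M} → d ⪯D bot → d ≡ bot
  ⪯bot⇒≡bot (inj₁ d≡bot) = d≡bot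
  ⪯bot⇒≡bot (inj₂ (inj₁ ()))
  ⪯bot⇒≡bot (inj₂ (inj₂ (_ , _ , _ , _ , () , _)))

  ≐-refl : {T : DSet n M} → T ≐ T
  ≐-refl d = (λ t → t) , (λ t → t)

  ≐-sym : {T₁ T₂ : DSet n M} → T₁ ≐ T₂ → T₂ ≐ T₁
  ≐-sym T₁≐T₂ d = proj₂ (T₁≐T₂ d) , proj₁ (T₁≐T₂ d)

  ≐-trans : {T₁ T₂ T₃ : DSet n M} → T₁ ≐ T₂ → T₂ ≐ T₃ → T₁ ≐ T₃
  ≐-trans T₁≐T₂ T₂≐T₃ d = (λ t → proj₁ (T₂≐T₃ d) (proj₁ (T₁≐T₂ d) t))
                         , (λ t → proj₂ (T₁≐T₂ d) (proj₂ (T₂≐T₃ d) t))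

  minD-nonempty : ExcludedMiddle 0ℓ → {T : DSet n M} → ∃ T → ∃ (minD T)
  minD-nonempty em {T} (_ , t) with wellFounded⇒minimal em ≺D-wellFounded T t
  ... | d , td , nothing-below =
    d , td , λ d′ td′ d′⪯d → em⇒dne em λ d′≢d → nothing-below (d′⪯d , d′≢d) td′

  minD-singleton : ∀ {T : DSet n M} {d} → T ≐ singleton d → minD T ≐ singleton d
  minD-singleton T≐d d′ =
      (λ m → proj₁ (T≐d d′) (proj₁ m))
    , λ d′≡d → proj₂ (T≐d d′) d′≡d
             , λ d″ td″ _ → trans (proj₁ (T≐d d″) td″) (sym d′≡d)

  minD-top : ∀ {T : DSet n M} → minD T top → T ≐ singleton top
  minD-top {T} (t , minimal) d = (λ td → minimal d td (inj₂ (inj₁ refl)))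
                               , (λ d≡top → subst T (sym d≡top) t)

  minD-bot : ∀ {T : DSet n M} → T bot → minD T ≐ singleton bot
  minD-bot {T} t d = (λ m → sym (proj₂ m bot t (inj₁ refl)))
                   , (λ d≡bot → subst (minD T) (sym d≡bot) (t , λ _ _ → ⪯bot⇒≡bot))

  ex-injectiveʳ : ∀ {o o′ : Node n} {a b : Prio M} → ex o a ≡ ex o′ b → a ≡ b
  ex-injectiveʳ refl = refl

  minD-ex-unique : ∀ {T : DSet n M} {o m₁ m₂} → minD T (ex o m₁) → minD T (ex o m₂) → m₁ ≡ m₂
  minD-ex-unique {o = o} {m₁} {m₂} (t₁ , minimal₁) (t₂ , minimal₂) with ⪯P-total m₁ m₂
  ... | inj₁ m₁⪯m₂ = ex-injectiveʳ (minimal₂ _ t₁ (inj₂ (inj₂ (o , m₁ , m₂ , refl , refl , m₁⪯m₂))))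
  ... | inj₂ m₂⪯m₁ = sym (ex-injectiveʳ (minimal₁ _ t₂ (inj₂ (inj₂ (o , m₂ , m₁ , refl , refl , m₂⪯m₁)))))

  ⪯U-top : ∀ {T₁ T₂ : DSet n M} → ∃ T₁ → T₂ ≐ singleton top → T₁ ⪯U T₂
  ⪯U-top (d , t) T₂≐top d₂ t₂ = d , t , inj₂ (inj₁ (proj₁ (T₂≐top d₂) t₂))

  ⪯U-of-bot : ∀ {T₁ T₂ : DSet n M} → T₁ bot → T₁ ⪯U T₂
  ⪯U-of-bot t _ _ = bot , t , inj₁ refl

  top-⪯U : ∀ {T : DSet n M} → singleton top ⪯U T → ∀ d → T d → d ≡ top
  top-⪯U top⪯T d t with top⪯T d t
  ... | _ , refl , top⪯d = top⪯⇒≡top top⪯d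

  ⪯U-bot : ∀ {T₁ T₂ : DSet n M} → T₁ ⪯U T₂ → T₂ bot → T₁ bot
  ⪯U-bot {T₁} T₁⪯T₂ t₂ with T₁⪯T₂ bot t₂
  ... | d , t₁ , d⪯bot = subst T₁ (⪯bot⇒≡bot d⪯bot) t₁

  MaxUIs : (DSet n M → Set) → DSet n M → Set₁
  MaxUIs S T₀ = ∀ T → (maxU S T → T ≐ T₀) × (T ≐ T₀ → maxU S T)

  MaxUIs⇒maxU : ∀ {S T₀} → MaxUIs S T₀ → maxU S T₀
  MaxUIs⇒maxU {T₀ = T₀} h = proj₂ (h T₀) ≐-refl

  maxU-bot : ∀ {S T T′} → maxU S T → T bot → S T′ → T′ bot
  maxU-bot (_ , maximal) t s′ = ⪯U-bot (maximal _ s′ (⪯U-of-bot t)) t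

  module _ (S : DSet n M → Set) (S-resp : ∀ {T T′} → T ≐ T′ → S T → S T′) where

    maxUIs-top : (∀ {T} → S T → ∃ T) → S (singleton top) → MaxUIs S (singleton top)
    maxUIs-top S-nonempty s-top T = optimal⇒top , top⇒optimal
      where
      optimal⇒top : maxU S T → T ≐ singleton top
      optimal⇒top (s , maximal) d = only-top d , λ { refl → subst T (only-top _ t) t }
        where
        only-top : ∀ d → T d → d ≡ top
        only-top = top-⪯U (maximal _ s-top (⪯U-top (S-nonempty s) ≐-refl))
        t : T (proj₁ (S-nonempty s))
        t = proj₂ (S-nonempty s)
      top⇒optimal : T ≐ singleton top → maxU S T
      top⇒optimal T≐top = S-resp (≐-sym T≐top) s-top , λ _ s′ _ → ⪯U-top (S-nonempty s′) T≐top

    maxUIs-bot : S (singleton bot) → (∀ {T} → S T → T ≐ singleton bot) → MaxUIs S (singleton bot)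
    maxUIs-bot s-bot all-bot T = (λ (s , _) → all-bot s) , bot⇒optimal
      where
      bot⇒optimal : T ≐ singleton bot → maxU S T
      bot⇒optimal T≐bot = S-resp (≐-sym T≐bot) s-bot
                        , λ _ s′ _ → ⪯U-of-bot (proj₂ (all-bot s′ bot) refl)

module _ {M n : ℕ} (A : OPG M n) where
  open OPG A using (Ω; total)
  open Sem A

  maxUpTo≤M : ∀ p j → maxUpTo p j ≤ M
  maxUpTo≤M p zero    = z≤n
  maxUpTo≤M p (suc j) = ⊔-lub (maxUpTo≤M p j) (toℕ≤M (Ω (p j) (p (suc j))))

  den-total : ExcludedMiddle 0ℓ → (p : Play) → ∃ (Den p)
  den-total em p with em {∃ λ k → IsExit (p k)}
  ... | yes (_ , exit) with wellFounded⇒minimal em <-wellFounded (λ k → IsExit (p k)) exit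
  ...   | j , exit-j , no-earlier-exit =
    ex (p j) (fromℕ< (s≤s (maxUpTo≤M p j))) , exit-j , j , refl
    , (λ k k<j pk≡pj → no-earlier-exit k<j (subst IsExit (sym pk≡pj) exit-j))
    , toℕ-fromℕ< _
  den-total em p | no no-exit with em {Parity p}
  ... | yes parity = top , (λ k exit → no-exit (k , exit)) , parity
  ... | no ¬parity = bot , (λ k exit → no-exit (k , exit)) , ¬parity

  some∃ : Strat∃
  some∃ {v} _ _ = total v

  some∀ : Strat∀
  some∀ {v} _ _ = total v

  outcomes-nonempty : ExcludedMiddle 0ℓ → ∀ (σ : Strat∃) v → ∃ (Outcomes σ v)
  outcomes-nonempty em σ v with den-total em (play σ some∀ v)
  ... | d , den = d , some∀ , den

  module _ {v : V} where

    minSets-resp : ∀ {T T′} → T ≐ T′ → MinSets v T → MinSets v T′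
    minSets-resp T≐T′ (σ , T≐min) = σ , ≐-trans (≐-sym T≐T′) T≐min

    minSets-nonempty : ExcludedMiddle 0ℓ → ∀ {T} → MinSets v T → ∃ T
    minSets-nonempty em (σ , T≐min) with minD-nonempty em (outcomes-nonempty em σ v)
    ... | d , min = d , proj₂ (T≐min d) min

    top-minimal⇒winning : ∀ {σ : Strat∃} → minD (Outcomes σ v) top → Winning v
    top-minimal⇒winning {σ} m = σ , ≐-sym (minD-top m)

    losing⇒minSets-bot : Losing v → ∀ {T} → MinSets v T → T ≐ singleton bot
    losing⇒minSets-bot l (σ , T≐min) = ≐-trans T≐min (minD-bot (l _ (σ , ≐-refl)))

    minSets-bot⇒losing : (∀ {T} → MinSets v T → T bot) → Losing v
    minSets-bot⇒losing all-bot T (σ , T≐out) = proj₂ (T≐out bot) (proj₁ (all-bot (σ , ≐-refl)))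

    winning⇒PF-top : ExcludedMiddle 0ℓ → Winning v → PFIs v (singleton top)
    winning⇒PF-top em (σ , top≐out) =
      maxUIs-top (MinSets v) minSets-resp (minSets-nonempty em) (σ , ≐-sym (minD-singleton (≐-sym top≐out)))

    PF-top⇒winning : PFIs v (singleton top) → Winning v
    PF-top⇒winning pf with MaxUIs⇒maxU pf
    ... | (σ , top≐min) , _ = top-minimal⇒winning (proj₁ (top≐min top) refl)

    losing⇒PF-bot : Losing v → PFIs v (singleton bot)
    losing⇒PF-bot l = maxUIs-bot (MinSets v) minSets-resp
      (minSets-resp (losing⇒minSets-bot l some-minSet) some-minSet) (losing⇒minSets-bot l)
      where
      some-minSet : MinSets v (minD (Outcomes some∃ v))
      some-minSet = some∃ , ≐-refl

    PF-bot⇒losing : PFIs v (singleton bot) → Losing v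
    PF-bot⇒losing pf = minSets-bot⇒losing λ s → maxU-bot (MaxUIs⇒maxU pf) refl s

    pending⇒shape : Pending v → PendingShape v
    pending⇒shape (¬winning , ¬losing) T (s@(σ , T≐min) , maximal) =
        (λ t → ¬winning (top-minimal⇒winning (proj₁ (T≐min top) t)))
      , (λ t → ¬losing (minSets-bot⇒losing (maxU-bot (s , maximal) t)))
      , λ { _ _ _ _ t₁ t₂ refl → minD-ex-unique (proj₁ (T≐min _) t₁) (proj₁ (T≐min _) t₂) }

    shape⇒pending : ExcludedMiddle 0ℓ → PendingShape v → Pending v
    shape⇒pending em shape =
        (λ w → proj₁ (shape _ (MaxUIs⇒maxU (winning⇒PF-top em w))) refl)
      , (λ l → proj₁ (proj₂ (shape _ (MaxUIs⇒maxU (losing⇒PF-bot l)))) refl)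

lemma3p21 : ExcludedMiddle (Level.suc 0ℓ) →
    (M : ℕ) → 2 ≤ M → EvenN M → (n : ℕ) → (A : OPG M n) →
    (i : Sem.V A) → Sem.IsEntrance A i →
    (Sem.Winning A i ⇔ Sem.PFIs A i (singleton top))
    × (Sem.Losing A i ⇔ Sem.PFIs A i (singleton bot))
    × (Sem.Pending A i ⇔ Sem.PendingShape A i)
lemma3p21 em M _ _ n A i _ =
    mk⇔ (winning⇒PF-top A em′) (PF-top⇒winning A)
  , mk⇔ (losing⇒PF-bot A) (PF-bot⇒losing A)
  , mk⇔ (pending⇒shape A) (shape⇒pending A em′)
  where
  em′ : ExcludedMiddle 0ℓ
  em′ = lowerEM em
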